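{- Let $\phi$ be a predicate on an inhabited set $A$. Then $(\forall x\in A.\,\phi(x))^\star\equiv\bigsqcup_{x\in A}(\phi(x))^\star$ holds if and only if $\exists x\in A\,(\phi(x)\Rightarrow\forall y\in A.\,\phi(y))$.
   Context: Work in intuitionistic higher-order logic (e.g. the internal language of an elementary topos), without excluded middle and without countable choice. A predicate $\phi$ on a set $A$ is a subset of $A$. A predicate $\phi$ on $A$ is instance reducible to a predicate $\psi$ on $B$, written $\phi\sqsubseteq\psi$, when $\forall x\in A\,\exists y\in B\,(\psi(y)\Rightarrow\phi(x))$; $\equiv$ is mutual reducibility. For a truth value $p$, $p^\star$ is the predicate on $\mathbf 1=\{\star\}$ with $p^\star(\star)=p$. For a family $(\phi_i)_{i\in I}$ of predicates on sets $A_i$, $\bigsqcup_{i\in I}\phi_i$ is the predicate on $\coprod_{i\in I}A_i$ given by $(\bigsqcup_i\phi_i)(\iota_i(x))\iff\phi_i(x)$ (this represents the supremum of the degrees). -}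

module Defs where

open import Data.Product using (Σ; Σ-syntax; _×_; _,_)
open import Data.Unit using (⊤; tt)

Pred : Set → Set₁
Pred A = A → Set

_⊑_ : {A B : Set} → Pred A → Pred B → Set
_⊑_ {A} {B} φ ψ = (x : A) → Σ[ y ∈ B ] (ψ y → φ x)

_≡ᵣ_ : {A B : Set} → Pred A → Pred B → Set
φ ≡ᵣ ψ = (φ ⊑ ψ) × (ψ ⊑ φ)

_⋆ : Set → Pred ⊤
(p ⋆) _ = p

⨆ : (I : Set) (A : I → Set) → ((i : I) → Pred (A i)) → Pred (Σ I A)
⨆ I A φ (i , x) = φ i x

module Submission where

open import Defs
open import Data.Product using (Σ; Σ-syntax; _×_; _,_)
open import Data.Unit using (⊤; tt)
open import Function.Bundles using (_⇔_; mk⇔; Equivalence)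

module _ {A : Set} (φ : Pred A) where

  ⨆⋆ : Pred (Σ A (λ _ → ⊤))
  ⨆⋆ = ⨆ A (λ _ → ⊤) (λ x → (φ x) ⋆)

  ⨆⋆⊑∀⋆ : ⨆⋆ ⊑ (((x : A) → φ x) ⋆)
  ⨆⋆⊑∀⋆ (y , _) = tt , λ ∀φ → ∀φ y

  ∀⋆⊑⨆⋆⇔drinker : (((x : A) → φ x) ⋆) ⊑ ⨆⋆ ⇔ (Σ[ x ∈ A ] (φ x → (y : A) → φ y))
  ∀⋆⊑⨆⋆⇔drinker = mk⇔ to from
    where
    to : (((x : A) → φ x) ⋆) ⊑ ⨆⋆ → Σ[ x ∈ A ] (φ x → (y : A) → φ y)
    to reduce = let (x , _) , φx⇒∀φ = reduce tt in x , φx⇒∀φ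

    from : Σ[ x ∈ A ] (φ x → (y : A) → φ y) → (((x : A) → φ x) ⋆) ⊑ ⨆⋆
    from (x , φx⇒∀φ) _ = (x , tt) , φx⇒∀φ

proposition2p12 : (A : Set) → (a : A) → (φ : Pred A) →
    (((((x : A) → φ x) ⋆) ≡ᵣ ⨆ A (λ _ → ⊤) (λ x → (φ x) ⋆))
    ⇔ (Σ[ x ∈ A ] (φ x → (y : A) → φ y)))
proposition2p12 A _ φ = mk⇔
  (λ (∀⋆⊑⨆⋆ , _) → to ∀⋆⊑⨆⋆)
  (λ drinker → from drinker , ⨆⋆⊑∀⋆ φ)
  where open Equivalence (∀⋆⊑⨆⋆⇔drinker φ)
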